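{- Let $n\geq 1$ and let $\mathbf{a}^{(1)},\ldots,\mathbf{a}^{(n-1)}\in\mathbb{R}^n$ be the standard increasing convex vectors and $\mathbf{1}=(1,\ldots,1)$. Then $\mathbf{a}^{(1)},\ldots,\mathbf{a}^{(n-1)}$ are linearly independent and together with $\mathbf{1}$ form a basis of $\mathbb{R}^n$. Moreover, every positive increasing convex vector $\mathbf{c}\in\mathbb{R}^n$ can be written uniquely as $$\mathbf{c}=\lambda_1\mathbf{a}^{(1)}+\cdots+\lambda_{n-1}\mathbf{a}^{(n-1)}+\lambda_n\mathbf{1}$$ with $\lambda_1,\ldots,\lambda_n\geq 0$.
   Context: A vector $\mathbf{a}=(a_1,\ldots,a_n)\in\mathbb{R}^n$ is positive if $a_i\geq 0$ for all $i$, increasing if $a_{i+1}-a_i\geq 0$ for all $1\le i<n$, and convex if $a_{i+1}-2a_i+a_{i-1}\geq 0$ for all $1<i<n$. For $1\leq i<n$, let $C_i$ be the set of positive increasing convex vectors in $\mathbb{R}^n$ with maximal component value $1$ having exactly $i$ components equal to $0$. The $i$-th standard increasing convex vector $\mathbf{a}^{(i)}$ is the unique maximal element of $C_i$ in the componentwise order; explicitly $a^{(i)}_j=\max\!\left(0,\frac{j-i}{n-i}\right)$ for $1\le j\le n$. -}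

module Defs where

open import Level using (0ℓ)
open import Data.Nat as ℕ using (ℕ; zero; suc; _∸_)
open import Data.Fin using (Fin; zero; suc; toℕ)
open import Data.Product using (Σ; ∃; _×_)
open import Relation.Binary.PropositionalEquality using (_≡_; _≢_)
open import Relation.Binary.Structures using (IsTotalOrder)
import Algebra.Structures as AS

-- The real numbers, axiomatised as a complete ordered field
-- (the axioms characterise ℝ up to isomorphism).  Equality is _≡_.
record RealField : Set₁ where
  infixl 6 _+_
  infixl 7 _*_
  infix 4 _≤_
  infix 8 -_
  field
    ℝ      : Set
    0ℝ 1ℝ  : ℝ
    _+_ _*_ : ℝ → ℝ → ℝ
    -_     : ℝ → ℝ
    _⁻¹    : ℝ → ℝ
    _≤_    : ℝ → ℝ → Set
    isCommutativeRing : AS.IsCommutativeRing {A = ℝ} _≡_ _+_ _*_ -_ 0ℝ 1ℝ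
    0≢1         : 0ℝ ≢ 1ℝ
    ⁻¹-inverse  : ∀ x → x ≢ 0ℝ → x * (x ⁻¹) ≡ 1ℝ
    ≤-isTotalOrder : IsTotalOrder _≡_ _≤_
    +-monoˡ-≤   : ∀ x y z → x ≤ y → x + z ≤ y + z
    *-nonneg    : ∀ x y → 0ℝ ≤ x → 0ℝ ≤ y → 0ℝ ≤ x * y
    completeness : (S : ℝ → Set) → ∃ S → (∃ λ b → ∀ x → S x → x ≤ b) →
                   ∃ λ s → (∀ x → S x → x ≤ s) × (∀ b → (∀ x → S x → x ≤ b) → s ≤ b)

  infixl 6 _-_
  _-_ : ℝ → ℝ → ℝ
  x - y = x + (- y)

  two : ℝ
  two = 1ℝ + 1ℝ

  fromℕ : ℕ → ℝ
  fromℕ zero    = 0ℝ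
  fromℕ (suc k) = 1ℝ + fromℕ k

  Σ[_] : ∀ {m} → (Fin m → ℝ) → ℝ
  Σ[_] {zero}  f = 0ℝ
  Σ[_] {suc m} f = f zero + Σ[ (λ k → f (suc k)) ]

  -- Vectors in ℝⁿ with n = suc m are functions Fin (suc m) → ℝ;
  -- component j (0-based) is the paper's component toℕ j + 1.

  Positive : ∀ {n} → (Fin n → ℝ) → Set
  Positive v = ∀ j → 0ℝ ≤ v j

  Increasing : ∀ {n} → (Fin n → ℝ) → Set
  Increasing v = ∀ i j → toℕ j ≡ suc (toℕ i) → 0ℝ ≤ v j - v i

  Convex : ∀ {n} → (Fin n → ℝ) → Set
  Convex v = ∀ h i j → toℕ i ≡ suc (toℕ h) → toℕ j ≡ suc (toℕ i) →
             0ℝ ≤ v j - two * v i + v h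

  𝟏 : ∀ {n} → Fin n → ℝ
  𝟏 _ = 1ℝ

  -- For k : Fin m, stdVec m k is a^(i) with i = toℕ k + 1 ∈ {1,…,n-1};
  -- its component at 1-based position J = toℕ j + 1 is
  --   max(0, (J - i)/(n - i)) = fromℕ (J ∸ i) * (fromℕ (n ∸ i))⁻¹
  -- (truncated subtraction gives exactly the max with 0, as n - i > 0).
  stdVec : (m : ℕ) → Fin m → Fin (suc m) → ℝ
  stdVec m k j = fromℕ (suc (toℕ j) ∸ suc (toℕ k)) * (fromℕ (suc m ∸ suc (toℕ k)) ⁻¹)

  comb : (m : ℕ) → (Fin m → ℝ) → ℝ → Fin (suc m) → ℝ
  comb m μ λn j = Σ[ (λ k → μ k * stdVec m k j) ] + λn * 𝟏 j

module Submission where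

-- Write n = m + 1 and index components by j = 0, …, m.
-- Dividing the coefficient of a^(i) by its denominator n − i turns the
-- combination μ₁ a^(1) + … + μ_{n-1} a^(n-1) + λ 𝟏 into the sequence
--     j ↦ λ + Σ_k D_k · (j − k)₊ ,        D_k = μ_k / (n − (k + 1)),
-- a piecewise-linear "ramp" sequence which starts at λ and whose slope
-- increases by D_k at position k.  Everything is therefore proved for the
-- more general ramp sequences  α + β·j + Σ_k D_k (j − k)₊  with an arbitrary
-- initial slope β, by induction on the number of kinks: dropping the first
-- value of such a sequence gives again a ramp sequence, with start value
-- α + (β + D₀) and slope β + D₀ ('ramps-step').  From this we get that the
-- values determine α and D ('ramps-start', 'ramps-kinks-determined'), that
-- every sequence is a ramp sequence with any prescribed initial slope
-- ('ramps-fit'), and that the kinks of a convex ramp sequence are second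
-- differences, hence nonnegative ('ramps-kinks-nonneg').
-- Translating back through the rescaling ('comb-as-ramps') gives
-- injectivity and surjectivity of (μ, λ) ↦ comb m μ λ and nonnegativity of
-- the coefficients of increasing convex vectors, from which the theorem follows.

open import Defs
open import Data.Nat using (ℕ; zero; suc; _∸_; _<_)
open import Data.Nat.Properties using (0∸n≡0; m<n⇒0<n∸m)
open import Data.Fin using (Fin; zero; suc; toℕ)
open import Data.Fin.Properties using (toℕ<n)
open import Data.Vec.Functional using (_∷_; tail)
open import Data.Product using (Σ; _×_; _,_; proj₁; proj₂)
open import Data.Sum using (inj₁; inj₂)
open import Function using (_∘_)
open import Relation.Binary.PropositionalEquality
  using (_≡_; _≢_; refl; sym; trans; cong; cong₂; subst; subst₂; module ≡-Reasoning)
open import Relation.Binary.Structures using (IsTotalOrder)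
open import Algebra.Bundles using (CommutativeRing)
import Algebra.Properties.Group as GroupProperties
import Algebra.Properties.Ring as RingProperties
import Algebra.Solver.Ring.NaturalCoefficients.Default as SemiringSolver

module RampBasis (R : RealField) where
  open RealField R
  open ≡-Reasoning

  private
    module ≤ = IsTotalOrder ≤-isTotalOrder
    ℝ-ring : CommutativeRing _ _
    ℝ-ring = record { isCommutativeRing = isCommutativeRing }
    module Ring = CommutativeRing ℝ-ring
    module +-Group = GroupProperties Ring.+-group
    module RingP = RingProperties Ring.ring
    open SemiringSolver Ring.commutativeSemiring using (solve; _:=_; _:+_; _:*_; con)

  -- Subtraction.  The semiring solver treats negatives as atoms, so the few
  -- facts that really use additive inverses are derived from group laws.

  add-sub : ∀ x y → x + (y - x) ≡ y
  add-sub x y = trans (Ring.+-comm x (y - x)) (+-Group.//-rightDividesˡ x y)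

  sub-of-add : ∀ {a b s} → b ≡ a + s → b - a ≡ s
  sub-of-add {a} {b} {s} b≡a+s =
    sym (+-Group.x≈z//y s a b (trans (Ring.+-comm s a) (sym b≡a+s)))

  second-difference : ∀ {a b c s d} → b ≡ a + s → c ≡ b + (s + d) → c - two * b + a ≡ d
  second-difference {a} {b} {c} {s} {d} b≡a+s c≡b+s+d = begin
    c - two * b + a    ≡⟨ solve 3 (λ c n a → c :+ n :+ a := (c :+ a) :+ n) refl c (- (two * b)) a ⟩
    (c + a) - two * b  ≡⟨ sub-of-add c+a≡2b+d ⟩
    d                  ∎
    where
    c+a≡2b+d : c + a ≡ two * b + d
    c+a≡2b+d = begin
      c + a              ≡⟨ cong (_+ a) c≡b+s+d ⟩
      b + (s + d) + a    ≡⟨ solve 4 (λ a b s d → b :+ (s :+ d) :+ a := b :+ (a :+ s) :+ d) refl a b s d ⟩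
      b + (a + s) + d    ≡⟨ cong (λ t → b + t + d) (sym b≡a+s) ⟩
      b + b + d          ≡⟨ solve 2 (λ b d → b :+ b :+ d := (con 1 :+ con 1) :* b :+ d) refl b d ⟩
      two * b + d        ∎

  *-⁻¹-cancel : ∀ {x} → x ≢ 0ℝ → ∀ y → (y * x) * x ⁻¹ ≡ y
  *-⁻¹-cancel {x} x≢0 y = begin
    (y * x) * x ⁻¹   ≡⟨ Ring.*-assoc y x (x ⁻¹) ⟩
    y * (x * x ⁻¹)   ≡⟨ cong (y *_) (⁻¹-inverse x x≢0) ⟩
    y * 1ℝ           ≡⟨ Ring.*-identityʳ y ⟩
    y                ∎

  ⁻¹-*-cancel : ∀ {x} → x ≢ 0ℝ → ∀ y → (y * x ⁻¹) * x ≡ y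
  ⁻¹-*-cancel {x} x≢0 y = begin
    (y * x ⁻¹) * x   ≡⟨ solve 3 (λ y i x → y :* i :* x := y :* x :* i) refl y (x ⁻¹) x ⟩
    (y * x) * x ⁻¹   ≡⟨ *-⁻¹-cancel x≢0 y ⟩
    y                ∎

  0≤+ : ∀ {a b} → 0ℝ ≤ a → 0ℝ ≤ b → 0ℝ ≤ a + b
  0≤+ {a} {b} 0≤a 0≤b =
    ≤.trans 0≤b (subst (_≤ a + b) (Ring.+-identityˡ b) (+-monoˡ-≤ 0ℝ a b 0≤a))

  0≤-x : ∀ {x} → x ≤ 0ℝ → 0ℝ ≤ - x
  0≤-x {x} x≤0 = subst₂ _≤_ (Ring.-‿inverseʳ x) (Ring.+-identityˡ (- x)) (+-monoˡ-≤ x 0ℝ (- x) x≤0)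

  -- either 0 ≤ 1, or 0 ≤ -1 and then 1 = (-1)·(-1) ≥ 0
  0≤1 : 0ℝ ≤ 1ℝ
  0≤1 with ≤.total 0ℝ 1ℝ
  ... | inj₁ 0≤1 = 0≤1
  ... | inj₂ 1≤0 = subst (0ℝ ≤_) -1*-1≡1 (*-nonneg (- 1ℝ) (- 1ℝ) (0≤-x 1≤0) (0≤-x 1≤0))
    where
    -1*-1≡1 : (- 1ℝ) * (- 1ℝ) ≡ 1ℝ
    -1*-1≡1 = begin
      (- 1ℝ) * (- 1ℝ)   ≡⟨ RingP.-1*x≈-x (- 1ℝ) ⟩
      - (- 1ℝ)          ≡⟨ +-Group.⁻¹-involutive 1ℝ ⟩
      1ℝ                ∎

  0≤fromℕ : ∀ k → 0ℝ ≤ fromℕ k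
  0≤fromℕ zero    = ≤.refl
  0≤fromℕ (suc k) = 0≤+ 0≤1 (0≤fromℕ k)

  fromℕ-nonzero : ∀ {k} → 0 < k → fromℕ k ≢ 0ℝ
  fromℕ-nonzero {suc t} _ 1+t≡0 = 0≢1 (≤.antisym 0≤1 (subst (1ℝ ≤_) 1+t≡0 1≤1+t))
    where
    1≤1+t : 1ℝ ≤ 1ℝ + fromℕ t
    1≤1+t = subst₂ _≤_ (Ring.+-identityˡ 1ℝ) (Ring.+-comm (fromℕ t) 1ℝ)
                   (+-monoˡ-≤ 0ℝ (fromℕ t) 1ℝ (0≤fromℕ t))

  Σ-cong : ∀ {k} {f g : Fin k → ℝ} → (∀ i → f i ≡ g i) → Σ[ f ] ≡ Σ[ g ]
  Σ-cong {zero}  f≗g = refl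
  Σ-cong {suc k} f≗g = cong₂ _+_ (f≗g zero) (Σ-cong (f≗g ∘ suc))

  Σ-zero : ∀ {k} {f : Fin k → ℝ} → (∀ i → f i ≡ 0ℝ) → Σ[ f ] ≡ 0ℝ
  Σ-zero {zero}  f≗0 = refl
  Σ-zero {suc k} f≗0 = trans (cong₂ _+_ (f≗0 zero) (Σ-zero (f≗0 ∘ suc))) (Ring.+-identityˡ 0ℝ)

  ramps : (m : ℕ) → ℝ → ℝ → (Fin m → ℝ) → ℕ → ℝ
  ramps m α β D j = α + β * fromℕ j + Σ[ (λ k → D k * fromℕ (j ∸ toℕ k)) ]

  ramps-cong : ∀ m α β {D D′ : Fin m → ℝ} → (∀ k → D k ≡ D′ k) →
               ∀ j → ramps m α β D j ≡ ramps m α β D′ j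
  ramps-cong m α β D≗D′ j =
    cong (α + β * fromℕ j +_) (Σ-cong (λ k → cong (_* fromℕ (j ∸ toℕ k)) (D≗D′ k)))

  ramps-at-0 : ∀ m α β (D : Fin m → ℝ) → ramps m α β D 0 ≡ α
  ramps-at-0 m α β D = begin
    α + β * 0ℝ + Σ[ (λ k → D k * fromℕ (0 ∸ toℕ k)) ]  ≡⟨ cong (α + β * 0ℝ +_) (Σ-zero no-kink-yet) ⟩
    α + β * 0ℝ + 0ℝ                                      ≡⟨ solve 2 (λ α β → α :+ β :* con 0 :+ con 0 := α) refl α β ⟩
    α                                                    ∎
    where
    no-kink-yet : ∀ k → D k * fromℕ (0 ∸ toℕ k) ≡ 0ℝ
    no-kink-yet k = trans (cong (λ t → D k * fromℕ t) (0∸n≡0 (toℕ k))) (Ring.zeroʳ (D k))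

  -- Dropping the first value: the first kink is absorbed into the slope.
  ramps-step : ∀ m α β (D : Fin (suc m) → ℝ) j →
               ramps (suc m) α β D (suc j) ≡ ramps m (α + (β + D zero)) (β + D zero) (tail D) j
  ramps-step m α β D j =
    solve 5 (λ α β d J X → α :+ β :* (con 1 :+ J) :+ (d :* (con 1 :+ J) :+ X)
                         := α :+ (β :+ d) :+ (β :+ d) :* J :+ X)
          refl α β (D zero) (fromℕ j) (Σ[ (λ k → D (suc k) * fromℕ (j ∸ toℕ k)) ])

  ramps-at-1 : ∀ m α β (D : Fin (suc m) → ℝ) → ramps (suc m) α β D 1 ≡ α + (β + D zero)
  ramps-at-1 m α β D = trans (ramps-step m α β D 0) (ramps-at-0 m _ _ _)

  ramps-first-increment : ∀ m α β (D : Fin (suc m) → ℝ) (v : Fin (suc (suc m)) → ℝ) →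
    (∀ j → v j ≡ ramps (suc m) α β D (toℕ j)) → v (suc zero) ≡ v zero + (β + D zero)
  ramps-first-increment m α β D v v≡ramps = begin
    v (suc zero)            ≡⟨ v≡ramps (suc zero) ⟩
    ramps (suc m) α β D 1   ≡⟨ ramps-at-1 m α β D ⟩
    α + (β + D zero)        ≡⟨ cong (_+ (β + D zero)) v₀≡α ⟨
    v zero + (β + D zero)   ∎
    where
    v₀≡α : v zero ≡ α
    v₀≡α = trans (v≡ramps zero) (ramps-at-0 (suc m) α β D)

  ramps-start : ∀ m {α α′ β β′} {D D′ : Fin m → ℝ} →
                ramps m α β D 0 ≡ ramps m α′ β′ D′ 0 → α ≡ α′
  ramps-start m {α} {α′} {β} {β′} {D} {D′} agree =
    trans (sym (ramps-at-0 m α β D)) (trans agree (ramps-at-0 m α′ β′ D′))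

  ramps-kinks-determined : ∀ m {α α′ β} {D D′ : Fin m → ℝ} →
    (∀ (j : Fin (suc m)) → ramps m α β D (toℕ j) ≡ ramps m α′ β D′ (toℕ j)) →
    ∀ k → D k ≡ D′ k
  ramps-kinks-determined zero    agree ()
  ramps-kinks-determined (suc m) {α} {α′} {β} {D} {D′} agree = kinks
    where
    α≡α′ : α ≡ α′
    α≡α′ = ramps-start (suc m) {D = D} {D′ = D′} (agree zero)
    D₀≡D₀′ : D zero ≡ D′ zero
    D₀≡D₀′ = RingP.+-cancelˡ β _ _ (RingP.+-cancelˡ α _ _ (begin
      α + (β + D zero)          ≡⟨ sym (ramps-at-1 m α β D) ⟩
      ramps (suc m) α β D 1     ≡⟨ agree (suc zero) ⟩
      ramps (suc m) α′ β D′ 1   ≡⟨ ramps-at-1 m α′ β D′ ⟩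
      α′ + (β + D′ zero)        ≡⟨ cong (_+ (β + D′ zero)) (sym α≡α′) ⟩
      α + (β + D′ zero)         ∎))
    -- after dropping the first value both sequences have the same slope again
    tails-agree : ∀ (j : Fin (suc m)) →
      ramps m (α + (β + D zero)) (β + D zero) (tail D) (toℕ j) ≡
      ramps m (α + (β + D zero)) (β + D zero) (tail D′) (toℕ j)
    tails-agree j = begin
      ramps m (α + (β + D zero)) (β + D zero) (tail D) (toℕ j)     ≡⟨ sym (ramps-step m α β D (toℕ j)) ⟩
      ramps (suc m) α β D (suc (toℕ j))                            ≡⟨ agree (suc j) ⟩
      ramps (suc m) α′ β D′ (suc (toℕ j))                          ≡⟨ ramps-step m α′ β D′ (toℕ j) ⟩
      ramps m (α′ + (β + D′ zero)) (β + D′ zero) (tail D′) (toℕ j)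
        ≡⟨ cong₂ (λ a d → ramps m (a + (β + d)) (β + d) (tail D′) (toℕ j)) (sym α≡α′) (sym D₀≡D₀′) ⟩
      ramps m (α + (β + D zero)) (β + D zero) (tail D′) (toℕ j)    ∎
    kinks : ∀ k → D k ≡ D′ k
    kinks zero    = D₀≡D₀′
    kinks (suc k) = ramps-kinks-determined m tails-agree k

  -- Every sequence of m + 1 values is a ramp sequence with m kinks, for any
  -- prescribed initial slope β: the first kink turns β into the first increment.
  ramps-fit : ∀ m β (v : Fin (suc m) → ℝ) →
              Σ (Fin m → ℝ) λ D → ∀ j → v j ≡ ramps m (v zero) β D (toℕ j)
  ramps-fit zero β v = (λ ()) , λ { zero → sym (ramps-at-0 zero (v zero) β (λ ())) }
  ramps-fit (suc m) β v = D₀ ∷ D′ , fits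
    where
    D₀ : ℝ
    D₀ = (v (suc zero) - v zero) - β
    reaches-v₁ : v zero + (β + D₀) ≡ v (suc zero)
    reaches-v₁ = trans (cong (v zero +_) (add-sub β _)) (add-sub (v zero) (v (suc zero)))
    D′ : Fin m → ℝ
    D′ = proj₁ (ramps-fit m (β + D₀) (tail v))
    fits : ∀ j → v j ≡ ramps (suc m) (v zero) β (D₀ ∷ D′) (toℕ j)
    fits zero    = sym (ramps-at-0 (suc m) (v zero) β (D₀ ∷ D′))
    fits (suc j) = begin
      v (suc j)                                           ≡⟨ proj₂ (ramps-fit m (β + D₀) (tail v)) j ⟩
      ramps m (v (suc zero)) (β + D₀) D′ (toℕ j)          ≡⟨ cong (λ a → ramps m a (β + D₀) D′ (toℕ j)) (sym reaches-v₁) ⟩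
      ramps m (v zero + (β + D₀)) (β + D₀) D′ (toℕ j)     ≡⟨ sym (ramps-step m (v zero) β (D₀ ∷ D′) (toℕ j)) ⟩
      ramps (suc m) (v zero) β (D₀ ∷ D′) (suc (toℕ j))    ∎

  -- The kink D k (k ≥ 1) is the second difference of the values at k − 1, k,
  -- k + 1, so a convex ramp sequence with nonnegative first kink has all
  -- kinks nonnegative.
  ramps-kinks-nonneg : ∀ m α β (D : Fin (suc m) → ℝ) (v : Fin (suc (suc m)) → ℝ) →
    (∀ j → v j ≡ ramps (suc m) α β D (toℕ j)) → Convex v → 0ℝ ≤ D zero → ∀ k → 0ℝ ≤ D k
  ramps-kinks-nonneg m       α β D v v≡ramps convex 0≤D₀ zero    = 0≤D₀
  ramps-kinks-nonneg (suc m) α β D v v≡ramps convex 0≤D₀ (suc k) =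
    ramps-kinks-nonneg m α′ β′ (tail D) (tail v) tail≡ramps tail-convex 0≤D₁ k
    where
    α′ β′ : ℝ
    β′ = β + D zero
    α′ = α + β′
    tail≡ramps : ∀ j → tail v j ≡ ramps (suc m) α′ β′ (tail D) (toℕ j)
    tail≡ramps j = trans (v≡ramps (suc j)) (ramps-step (suc m) α β D (toℕ j))
    tail-convex : Convex (tail v)
    tail-convex h i j i≡1+h j≡1+i = convex (suc h) (suc i) (suc j) (cong suc i≡1+h) (cong suc j≡1+i)
    0≤D₁ : 0ℝ ≤ D (suc zero)
    0≤D₁ = subst (0ℝ ≤_) (second-difference (ramps-first-increment (suc m) α β D v v≡ramps)
                                             (ramps-first-increment m α′ β′ (tail D) (tail v) tail≡ramps))
                 (convex zero (suc zero) (suc (suc zero)) refl refl)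

  -- An increasing convex ramp sequence starting with slope 0 has nonnegative
  -- kinks; the first kink is its first increment.
  ramps-nonneg : ∀ m α (D : Fin m → ℝ) (v : Fin (suc m) → ℝ) →
    (∀ j → v j ≡ ramps m α 0ℝ D (toℕ j)) → Increasing v → Convex v → ∀ k → 0ℝ ≤ D k
  ramps-nonneg zero    α D v v≡ramps increasing convex ()
  ramps-nonneg (suc m) α D v v≡ramps increasing convex =
    ramps-kinks-nonneg m α 0ℝ D v v≡ramps convex 0≤D₀
    where
    0≤D₀ : 0ℝ ≤ D zero
    0≤D₀ = subst (0ℝ ≤_) first-increment (increasing zero (suc zero) refl)
      where
      first-increment : v (suc zero) - v zero ≡ D zero
      first-increment = trans (sub-of-add (ramps-first-increment m α 0ℝ D v v≡ramps))
                              (Ring.+-identityˡ (D zero))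

  -- The rescaling between coefficients of standard vectors and kinks: the
  -- vector a^(i), i = k + 1, is the ramp with a single kink of size
  -- 1 / (n − i) at position k, and n − i = m − k is positive.

  denominator : (m : ℕ) → Fin m → ℝ
  denominator m k = fromℕ (m ∸ toℕ k)

  denominator-nonzero : ∀ m k → denominator m k ≢ 0ℝ
  denominator-nonzero m k = fromℕ-nonzero (m<n⇒0<n∸m (toℕ<n k))

  kinks : (m : ℕ) → (Fin m → ℝ) → Fin m → ℝ
  kinks m μ k = μ k * denominator m k ⁻¹

  kinks-denominator : ∀ m μ k → kinks m μ k * denominator m k ≡ μ k
  kinks-denominator m μ k = ⁻¹-*-cancel (denominator-nonzero m k) (μ k)

  comb-as-ramps : ∀ m μ λn (j : Fin (suc m)) →
                  comb m μ λn j ≡ ramps m λn 0ℝ (kinks m μ) (toℕ j)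
  comb-as-ramps m μ λn j = begin
    Σ[ (λ k → μ k * stdVec m k j) ] + λn * 1ℝ  ≡⟨ cong (_+ λn * 1ℝ) (Σ-cong single-kink) ⟩
    S + λn * 1ℝ                               ≡⟨ solve 3 (λ S λn J → S :+ λn :* con 1 := λn :+ con 0 :* J :+ S) refl S λn (fromℕ (toℕ j)) ⟩
    λn + 0ℝ * fromℕ (toℕ j) + S               ∎
    where
    S : ℝ
    S = Σ[ (λ k → kinks m μ k * fromℕ (toℕ j ∸ toℕ k)) ]
    single-kink : ∀ k → μ k * stdVec m k j ≡ kinks m μ k * fromℕ (toℕ j ∸ toℕ k)
    single-kink k = solve 3 (λ μ x d → μ :* (x :* d) := μ :* d :* x) refl
                            (μ k) (fromℕ (toℕ j ∸ toℕ k)) (denominator m k ⁻¹)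

  comb-zero : ∀ m j → comb m (λ _ → 0ℝ) 0ℝ j ≡ 0ℝ
  comb-zero m j = trans (cong₂ _+_ (Σ-zero (λ k → Ring.zeroˡ (stdVec m k j))) (Ring.zeroˡ 1ℝ))
                        (Ring.+-identityˡ 0ℝ)

  comb-injective : ∀ m {μ μ′ λn λn′} → (∀ j → comb m μ λn j ≡ comb m μ′ λn′ j) →
                   (∀ k → μ k ≡ μ′ k) × λn ≡ λn′
  comb-injective m {μ} {μ′} {λn} {λn′} agree =
    μ≡μ′ , ramps-start m {D = kinks m μ} {D′ = kinks m μ′} (as-ramps zero)
    where
    as-ramps : ∀ j → ramps m λn 0ℝ (kinks m μ) (toℕ j) ≡ ramps m λn′ 0ℝ (kinks m μ′) (toℕ j)
    as-ramps j = trans (sym (comb-as-ramps m μ λn j)) (trans (agree j) (comb-as-ramps m μ′ λn′ j))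
    μ≡μ′ : ∀ k → μ k ≡ μ′ k
    μ≡μ′ k = begin
      μ k                           ≡⟨ sym (kinks-denominator m μ k) ⟩
      kinks m μ k * denominator m k  ≡⟨ cong (_* denominator m k) (ramps-kinks-determined m as-ramps k) ⟩
      kinks m μ′ k * denominator m k ≡⟨ kinks-denominator m μ′ k ⟩
      μ′ k                          ∎

  comb-surjective : ∀ m (v : Fin (suc m) → ℝ) →
                    Σ (Fin m → ℝ) λ μ → Σ ℝ λ λn → ∀ j → v j ≡ comb m μ λn j
  comb-surjective m v = μ , v zero , represents
    where
    D : Fin m → ℝ
    D = proj₁ (ramps-fit m 0ℝ v)
    μ : Fin m → ℝ
    μ k = D k * denominator m k
    represents : ∀ j → v j ≡ comb m μ (v zero) j
    represents j = begin
      v j                                          ≡⟨ proj₂ (ramps-fit m 0ℝ v) j ⟩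
      ramps m (v zero) 0ℝ D (toℕ j)                ≡⟨ ramps-cong m (v zero) 0ℝ (λ k → sym (*-⁻¹-cancel (denominator-nonzero m k) (D k))) (toℕ j) ⟩
      ramps m (v zero) 0ℝ (kinks m μ) (toℕ j)      ≡⟨ sym (comb-as-ramps m μ (v zero) j) ⟩
      comb m μ (v zero) j                          ∎

  -- A positive increasing convex vector has nonnegative coefficients: λ is
  -- its first component, the first kink its first increment, and the other
  -- kinks are second differences.
  comb-coefficients-nonneg : ∀ m μ λn (c : Fin (suc m) → ℝ) → (∀ j → c j ≡ comb m μ λn j) →
    Positive c → Increasing c → Convex c → (∀ k → 0ℝ ≤ μ k) × 0ℝ ≤ λn
  comb-coefficients-nonneg m μ λn c c≡comb positive increasing convex =
    0≤μ , subst (0ℝ ≤_) c₀≡λn (positive zero)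
    where
    c≡ramps : ∀ j → c j ≡ ramps m λn 0ℝ (kinks m μ) (toℕ j)
    c≡ramps j = trans (c≡comb j) (comb-as-ramps m μ λn j)
    c₀≡λn : c zero ≡ λn
    c₀≡λn = trans (c≡ramps zero) (ramps-at-0 m λn 0ℝ (kinks m μ))
    0≤μ : ∀ k → 0ℝ ≤ μ k
    0≤μ k = subst (0ℝ ≤_) (kinks-denominator m μ k)
                  (*-nonneg _ _ (ramps-nonneg m λn (kinks m μ) c c≡ramps increasing convex k)
                                (0≤fromℕ (m ∸ toℕ k)))

  standard-independent : ∀ m (μ : Fin m → ℝ) →
    (∀ j → Σ[ (λ k → μ k * stdVec m k j) ] ≡ 0ℝ) → ∀ k → μ k ≡ 0ℝ
  standard-independent m μ sum≡0 = proj₁ (comb-injective m without-𝟏)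
    where
    without-𝟏 : ∀ j → comb m μ 0ℝ j ≡ comb m (λ _ → 0ℝ) 0ℝ j
    without-𝟏 j = begin
      Σ[ (λ k → μ k * stdVec m k j) ] + 0ℝ * 1ℝ  ≡⟨ solve 1 (λ S → S :+ con 0 :* con 1 := S) refl _ ⟩
      Σ[ (λ k → μ k * stdVec m k j) ]            ≡⟨ sum≡0 j ⟩
      0ℝ                                         ≡⟨ sym (comb-zero m j) ⟩
      comb m (λ _ → 0ℝ) 0ℝ j                     ∎

  basis-independent : ∀ m (μ : Fin m → ℝ) λn →
    (∀ j → comb m μ λn j ≡ 0ℝ) → (∀ k → μ k ≡ 0ℝ) × λn ≡ 0ℝ
  basis-independent m μ λn comb≡0 = comb-injective m (λ j → trans (comb≡0 j) (sym (comb-zero m j)))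

  nonneg-representation : ∀ m (c : Fin (suc m) → ℝ) → Positive c → Increasing c → Convex c →
    Σ (Fin m → ℝ) λ μ → Σ ℝ λ λn →
      (∀ k → 0ℝ ≤ μ k) × 0ℝ ≤ λn × (∀ j → c j ≡ comb m μ λn j)
      × ((μ′ : Fin m → ℝ) → (λn′ : ℝ) → (∀ k → 0ℝ ≤ μ′ k) → 0ℝ ≤ λn′ →
           (∀ j → c j ≡ comb m μ′ λn′ j) → (∀ k → μ′ k ≡ μ k) × λn′ ≡ λn)
  nonneg-representation m c positive increasing convex =
    let (μ , λn , c≡comb) = comb-surjective m c
        (0≤μ , 0≤λn)     = comb-coefficients-nonneg m μ λn c c≡comb positive increasing convex
    in μ , λn , 0≤μ , 0≤λn , c≡comb ,
       λ μ′ λn′ _ _ c≡comb′ → comb-injective m (λ j → trans (sym (c≡comb′ j)) (c≡comb j))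

mainTheorem2 : (R : RealField) → let open RealField R in (m : ℕ) →
      ((μ : Fin m → ℝ) → (∀ j → Σ[ (λ k → μ k * stdVec m k j) ] ≡ 0ℝ) → ∀ k → μ k ≡ 0ℝ)
    × ((μ : Fin m → ℝ) → (λn : ℝ) → (∀ j → comb m μ λn j ≡ 0ℝ) → (∀ k → μ k ≡ 0ℝ) × λn ≡ 0ℝ)
    × ((v : Fin (suc m) → ℝ) → Σ (Fin m → ℝ) λ μ → Σ ℝ λ λn → ∀ j → v j ≡ comb m μ λn j)
    × ((c : Fin (suc m) → ℝ) → Positive c → Increasing c → Convex c →
        Σ (Fin m → ℝ) λ μ → Σ ℝ λ λn →
          (∀ k → 0ℝ ≤ μ k) × 0ℝ ≤ λn × (∀ j → c j ≡ comb m μ λn j)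
          × ((μ′ : Fin m → ℝ) → (λn′ : ℝ) → (∀ k → 0ℝ ≤ μ′ k) → 0ℝ ≤ λn′ →
               (∀ j → c j ≡ comb m μ′ λn′ j) → (∀ k → μ′ k ≡ μ k) × λn′ ≡ λn))
mainTheorem2 R m =
  standard-independent m , basis-independent m , comb-surjective m , nonneg-representation m
  where open RampBasis R
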